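{- In a Boolean modal quasi-pretopos $(\mathcal{E},\mathcal{M},\mathcal{Q})$, the class $\mathcal{M}$ coincides with the class of regular monomorphisms of $\mathcal{E}$.
   Context: An f-regular category is a pair $(\mathcal{E},\mathcal{M})$ where $\mathcal{E}$ has finite limits and $\mathcal{M}$ is a class of monomorphisms containing all isomorphisms and regular monomorphisms, closed under composition and pullback, such that every arrow factors as $m\circ e$ with $m\in\mathcal{M}$ and $e\in\mathcal{M}^\bot$ (arrows left orthogonal to all of $\mathcal{M}$), with $\mathcal{M}^\bot$ pullback-stable. $\mathrm{Sub}_{\mathcal{M}}(X)$ is the poset of $\mathcal{M}$-subobjects; $f^*$ pullback, $\exists_f$ its left adjoint. f-coherent: each $\mathrm{Sub}_{\mathcal{M}}(X)$ has finite joins preserved by $f^*$; Boolean: each $\mathrm{Sub}_{\mathcal{M}}(X)$ is a Boolean algebra. A Boolean modal category is a Boolean f-coherent category with join-preserving operators $\Diamond_X$ on $\mathrm{Sub}_{\mathcal{M}}(X)$ such that $\Diamond_Xf^*S\le f^*\Diamond_YS$ for all $f:X\to Y$ and $\Diamond_A\iota^*S=\iota^*\Diamond_X\exists_\iota\iota^*S$ for $\iota:A\hookrightarrow X$ in $\mathcal{M}$. A Boolean modal category with quotients has moreover a class $\mathcal{Q}\subseteq\mathcal{M}^\bot$ with $\Diamond S\le\exists_{q\times1_Z}\Diamond(q\times1_Z)^*S$ for all $q:X\to Y$ in $\mathcal{Q}$, objects $Z$ and $S\in\mathrm{Sub}_{\mathcal{M}}(Y\times Z)$. A disjoint union of $A,B$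 is an object $A+B$ with $\mathcal{M}$-subobjects $\iota_A:A\hookrightarrow A+B$, $\iota_B:B\hookrightarrow A+B$ which are Boolean complements in $\mathrm{Sub}_{\mathcal{M}}(A+B)$ with $\Diamond A\le A$, $\Diamond B\le B$. A Boolean modal quasi-pretopos is a Boolean modal category with quotients in which every pair of objects has a disjoint union and every equivalence relation $R\in\mathrm{Sub}_{\mathcal{M}}(X\times X)$ is the kernel pair of some quotient $q:X\to Q$. -}

module Defs where

open import Level using (Level; _⊔_) renaming (suc to lsuc)
open import Relation.Binary.PropositionalEquality using (_≡_)
open import Data.Product using (Σ; Σ-syntax; _×_; _,_; proj₁; proj₂)
open import Data.Unit.Polymorphic using (⊤)

UniqueEx : ∀ {a b} {A : Set a} → (A → Set b) → Set (a ⊔ b)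
UniqueEx {A = A} P = Σ A λ x → P x × (∀ y → P y → x ≡ y)

record Category (o ℓ : Level) : Set (lsuc (o ⊔ ℓ)) where
  infixr 9 _∘_
  field
    Obj : Set o
    Hom : Obj → Obj → Set ℓ
    id  : ∀ {A} → Hom A A
    _∘_ : ∀ {A B C} → Hom B C → Hom A B → Hom A C
    identityˡ : ∀ {A B} {f : Hom A B} → id ∘ f ≡ f
    identityʳ : ∀ {A B} {f : Hom A B} → f ∘ id ≡ f
    assoc : ∀ {A B C D} {f : Hom A B} {g : Hom B C} {h : Hom C D} →
            (h ∘ g) ∘ f ≡ h ∘ (g ∘ f)

module CatDefs {o ℓ : Level} (C : Category o ℓ) where
  open Category C

  Mono : ∀ {A B} → Hom A B → Set (o ⊔ ℓ)
  Mono {A} m = ∀ {Z} (g h : Hom Z A) → m ∘ g ≡ m ∘ h → g ≡ h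

  IsIso : ∀ {A B} → Hom A B → Set ℓ
  IsIso {A} {B} f = Σ (Hom B A) λ g → (g ∘ f ≡ id) × (f ∘ g ≡ id)

  IsEqualizer : ∀ {E A B} → Hom E A → Hom A B → Hom A B → Set (o ⊔ ℓ)
  IsEqualizer {E} {A} e f g =
    (f ∘ e ≡ g ∘ e) ×
    (∀ {Z} (h : Hom Z A) → f ∘ h ≡ g ∘ h → UniqueEx (λ (u : Hom Z E) → e ∘ u ≡ h))

  RegularMono : ∀ {E A} → Hom E A → Set (o ⊔ ℓ)
  RegularMono {E} {A} m =
    Σ Obj λ B → Σ (Hom A B) λ f → Σ (Hom A B) λ g → IsEqualizer m f g

  IsPullback : ∀ {P A B X} → Hom A X → Hom B X → Hom P A → Hom P B → Set (o ⊔ ℓ)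
  IsPullback {P} {A} {B} f g p₁ p₂ =
    (f ∘ p₁ ≡ g ∘ p₂) ×
    (∀ {Z} (h : Hom Z A) (k : Hom Z B) → f ∘ h ≡ g ∘ k →
       UniqueEx (λ (u : Hom Z P) → (p₁ ∘ u ≡ h) × (p₂ ∘ u ≡ k)))

  IsTerminal : Obj → Set (o ⊔ ℓ)
  IsTerminal T = ∀ A → UniqueEx (λ (_ : Hom A T) → ⊤ {ℓ})

  IsProduct : ∀ {P A B} → Hom P A → Hom P B → Set (o ⊔ ℓ)
  IsProduct {P} {A} {B} π₁ π₂ =
    ∀ {Z} (h : Hom Z A) (k : Hom Z B) →
      UniqueEx (λ (u : Hom Z P) → (π₁ ∘ u ≡ h) × (π₂ ∘ u ≡ k))

  record Pullback {A B X : Obj} (f : Hom A X) (g : Hom B X) : Set (o ⊔ ℓ) where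
    field
      P  : Obj
      p₁ : Hom P A
      p₂ : Hom P B
      isPullback : IsPullback f g p₁ p₂

  record Product (A B : Obj) : Set (o ⊔ ℓ) where
    field
      obj : Obj
      π₁  : Hom obj A
      π₂  : Hom obj B
      isProduct : IsProduct π₁ π₂

  record FiniteLimits : Set (o ⊔ ℓ) where
    field
      terminal : Σ Obj IsTerminal
      product  : ∀ A B → Product A B
      pullback : ∀ {A B X} (f : Hom A X) (g : Hom B X) → Pullback f g

  MorClass : (p : Level) → Set (o ⊔ ℓ ⊔ lsuc p)
  MorClass p = ∀ {A B} → Hom A B → Set p

  LeftOrth : ∀ {A B C D} → Hom A B → Hom C D → Set ℓ
  LeftOrth {A} {B} {C} {D} e m =
    ∀ {u : Hom A C} {v : Hom B D} → m ∘ u ≡ v ∘ e →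
      UniqueEx (λ (d : Hom B C) → (d ∘ e ≡ u) × (m ∘ d ≡ v))

  Perp : ∀ {p} → MorClass p → MorClass (o ⊔ ℓ ⊔ p)
  Perp M e = ∀ {C D} (m : Hom C D) → M m → LeftOrth e m

record IsFRegular {o ℓ p} (C : Category o ℓ) (M : CatDefs.MorClass C p)
       : Set (o ⊔ ℓ ⊔ p) where
  open Category C
  open CatDefs C
  field
    limits : FiniteLimits
    M-mono : ∀ {A B} {m : Hom A B} → M m → Mono m
    iso⊆M  : ∀ {A B} {f : Hom A B} → IsIso f → M f
    reg⊆M  : ∀ {A B} {f : Hom A B} → RegularMono f → M f
    M-comp : ∀ {A B D} {f : Hom A B} {g : Hom B D} → M f → M g → M (g ∘ f)
    M-pb   : ∀ {P A B X} {f : Hom A X} {m : Hom B X} {p₁ : Hom P A} {p₂ : Hom P B} →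
             IsPullback f m p₁ p₂ → M m → M p₁
    factor : ∀ {A B} (f : Hom A B) →
             Σ Obj λ I → Σ (Hom I B) λ m → Σ (Hom A I) λ e →
               M m × Perp M e × (m ∘ e ≡ f)
    Perp-pb : ∀ {P A B X} {f : Hom A X} {e : Hom B X} {p₁ : Hom P A} {p₂ : Hom P B} →
              IsPullback f e p₁ p₂ → Perp M e → Perp M p₁

record FRegularCategory (o ℓ p : Level) : Set (lsuc (o ⊔ ℓ ⊔ p)) where
  field
    cat : Category o ℓ
    M   : CatDefs.MorClass cat p
    isFRegular : IsFRegular cat M

-- Boolean algebra structure on a preorder (i.e. on its poset reflection)

record IsBooleanPreorder {a r} {A : Set a} (_≤_ : A → A → Set r) : Set (a ⊔ r) where
  field
    bot top : A
    _∧_ _∨_ : A → A → A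
    ¬_ : A → A
    bot-min : ∀ x → bot ≤ x
    top-max : ∀ x → x ≤ top
    ∧-lb₁ : ∀ x y → (x ∧ y) ≤ x
    ∧-lb₂ : ∀ x y → (x ∧ y) ≤ y
    ∧-glb : ∀ {x y z} → z ≤ x → z ≤ y → z ≤ (x ∧ y)
    ∨-ub₁ : ∀ x y → x ≤ (x ∨ y)
    ∨-ub₂ : ∀ x y → y ≤ (x ∨ y)
    ∨-lub : ∀ {x y z} → x ≤ z → y ≤ z → (x ∨ y) ≤ z
    distrib : ∀ x y z → (x ∧ (y ∨ z)) ≤ ((x ∧ y) ∨ (x ∧ z))
    compl-∧ : ∀ x → (x ∧ (¬ x)) ≤ bot
    compl-∨ : ∀ x → top ≤ (x ∨ (¬ x))

module FRegDefs {o ℓ p} (F : FRegularCategory o ℓ p) where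
  open FRegularCategory F public using (M)
  open FRegularCategory F using (cat; isFRegular)
  open Category cat public
  open CatDefs cat public
  open IsFRegular isFRegular public
  open FiniteLimits limits public

  record Sub (X : Obj) : Set (o ⊔ ℓ ⊔ p) where
    constructor sub
    field
      dom : Obj
      arr : Hom dom X
      inM : M arr
  open Sub public

  _≤_ : ∀ {X} → Sub X → Sub X → Set ℓ
  S ≤ T = Σ (Hom (dom S) (dom T)) λ h → arr T ∘ h ≡ arr S

  _≅_ : ∀ {X} → Sub X → Sub X → Set ℓ
  S ≅ T = (S ≤ T) × (T ≤ S)

  _* : ∀ {X Y} → Hom X Y → Sub Y → Sub X
  (f *) S = sub (Pullback.P pb) (Pullback.p₁ pb) (M-pb (Pullback.isPullback pb) (inM S))
    where pb = pullback f (arr S)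

  ∃⟨_⟩ : ∀ {X Y} → Hom X Y → Sub X → Sub Y
  ∃⟨ f ⟩ S = sub (proj₁ fac) (proj₁ (proj₂ fac)) (proj₁ (proj₂ (proj₂ (proj₂ fac))))
    where fac = factor (f ∘ arr S)

  _⊗_ : Obj → Obj → Obj
  A ⊗ B = Product.obj (product A B)

  π₁ : ∀ {A B} → Hom (A ⊗ B) A
  π₁ {A} {B} = Product.π₁ (product A B)

  π₂ : ∀ {A B} → Hom (A ⊗ B) B
  π₂ {A} {B} = Product.π₂ (product A B)

  ⟨_,_⟩ : ∀ {Z A B} → Hom Z A → Hom Z B → Hom Z (A ⊗ B)
  ⟨_,_⟩ {A = A} {B} h k = proj₁ (Product.isProduct (product A B) h k)

  _×₁_ : ∀ {X Y} → Hom X Y → (Z : Obj) → Hom (X ⊗ Z) (Y ⊗ Z)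
  q ×₁ Z = ⟨ q ∘ π₁ , π₂ ⟩

  record IsEquivalenceRel {X : Obj} (R : Sub (X ⊗ X)) : Set (o ⊔ ℓ) where
    r₁ : Hom (dom R) X
    r₁ = π₁ ∘ arr R
    r₂ : Hom (dom R) X
    r₂ = π₂ ∘ arr R
    pb : Pullback r₂ r₁
    pb = pullback r₂ r₁
    field
      reflexive  : Σ (Hom X (dom R)) λ h → arr R ∘ h ≡ ⟨ id , id ⟩
      symmetric  : Σ (Hom (dom R) (dom R)) λ s → arr R ∘ s ≡ ⟨ r₂ , r₁ ⟩
      transitive : Σ (Hom (Pullback.P pb) (dom R)) λ t →
                     arr R ∘ t ≡ ⟨ r₁ ∘ Pullback.p₁ pb , r₂ ∘ Pullback.p₂ pb ⟩

record IsBooleanModal {o ℓ p} (F : FRegularCategory o ℓ p) : Set (o ⊔ ℓ ⊔ p) where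
  open FRegDefs F
  field
    bool : ∀ X → IsBooleanPreorder (_≤_ {X})
  module BA (X : Obj) = IsBooleanPreorder (bool X)
  field
    *-bot  : ∀ {X Y} (f : Hom X Y) → (f *) (BA.bot Y) ≤ BA.bot X
    *-join : ∀ {X Y} (f : Hom X Y) (S T : Sub Y) →
             (f *) (BA._∨_ Y S T) ≤ BA._∨_ X ((f *) S) ((f *) T)
    ◇ : ∀ {X} → Sub X → Sub X
    ◇-mono : ∀ {X} {S T : Sub X} → S ≤ T → ◇ S ≤ ◇ T
    ◇-bot  : ∀ X → ◇ (BA.bot X) ≤ BA.bot X
    ◇-join : ∀ {X} (S T : Sub X) → ◇ (BA._∨_ X S T) ≤ BA._∨_ X (◇ S) (◇ T)
    ◇-nat  : ∀ {X Y} (f : Hom X Y) (S : Sub Y) → ◇ ((f *) S) ≤ (f *) (◇ S)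
    ◇-restr : ∀ {A X} (ι : Hom A X) → M ι → (S : Sub X) →
              ◇ ((ι *) S) ≅ (ι *) (◇ (∃⟨ ι ⟩ ((ι *) S)))

record IsBooleanModalWithQuotients {o ℓ p} (F : FRegularCategory o ℓ p)
       (q : Level) : Set (o ⊔ ℓ ⊔ p ⊔ lsuc q) where
  open FRegDefs F
  field
    isBooleanModal : IsBooleanModal F
  open IsBooleanModal isBooleanModal
  field
    Q : MorClass q
    Q⊆Perp : ∀ {X Y} {f : Hom X Y} → Q f → Perp (FRegularCategory.M F) f
    quot : ∀ {X Y Z} (f : Hom X Y) → Q f → (S : Sub (Y ⊗ Z)) →
           ◇ S ≤ ∃⟨ f ×₁ Z ⟩ (◇ (((f ×₁ Z) *) S))

record DisjointUnion {o ℓ p} (F : FRegularCategory o ℓ p) (bm : IsBooleanModal F)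
       (A B : FRegDefs.Obj F) : Set (o ⊔ ℓ ⊔ p) where
  open FRegDefs F
  open IsBooleanModal bm
  field
    U   : Obj
    ιA  : Hom A U
    ιB  : Hom B U
    ιA∈M : FRegularCategory.M F ιA
    ιB∈M : FRegularCategory.M F ιB
  SA : Sub U
  SA = sub A ιA ιA∈M
  SB : Sub U
  SB = sub B ιB ιB∈M
  field
    meet-bot : BA._∧_ U SA SB ≤ BA.bot U
    join-top : BA.top U ≤ BA._∨_ U SA SB
    ◇A : ◇ SA ≤ SA
    ◇B : ◇ SB ≤ SB

record BooleanModalQuasiPretopos (o ℓ p q : Level) : Set (lsuc (o ⊔ ℓ ⊔ p ⊔ q)) where
  field
    F : FRegularCategory o ℓ p
  open FRegDefs F
  field
    isBMQ : IsBooleanModalWithQuotients F q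
  open IsBooleanModalWithQuotients isBMQ
  field
    disjointUnion : ∀ A B → DisjointUnion F isBooleanModal A B
    effective : ∀ {X} (R : Sub (X ⊗ X)) → IsEquivalenceRel R →
                Σ Obj λ Y → Σ (Hom X Y) λ f →
                  Q f × IsPullback f f (π₁ ∘ arr R) (π₂ ∘ arr R)

{-# OPTIONS --safe #-}
-- Glue two copies of B along m. In the disjoint union U = B + B, with injections i₁ and
-- i₂, let R ⊆ U × U be the join of the diagonal with ⟨i₁ m, i₂ m⟩ and ⟨i₂ m, i₁ m⟩.
-- Joins of M-subobjects are stable under pullback, so a generalized element of R can
-- be analysed case by case after refining its domain, and disjointness of i₁ and i₂
-- disposes of the mixed cases: R is an equivalence relation. Its quotient q has kernel
-- pair R, and ⟨i₁ h, i₂ h⟩ lies in R only where h factors through m, so m is the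
-- equalizer of q i₁ and q i₂. The converse inclusion is an axiom of f-regular
-- categories.
module Submission where

open import Defs
open import Level using (_⊔_)
open import Data.Product using (Σ; _×_; _,_; proj₁; proj₂)
open import Relation.Binary.PropositionalEquality
  using (_≡_; refl; sym; trans; cong; cong₂; subst; isEquivalence; module ≡-Reasoning)
open import Relation.Binary.Structures using (IsPreorder)
open import Relation.Binary.Bundles using (Preorder)
import Relation.Binary.Reasoning.Preorder

module FRegularProperties {o ℓ p} (F : FRegularCategory o ℓ p) where
  open FRegDefs F
  open ≡-Reasoning

  project₁ : ∀ {Z A B} {f : Hom Z A} {g : Hom Z B} → π₁ ∘ ⟨ f , g ⟩ ≡ f
  project₁ {A = A} {B} {f} {g} = proj₁ (proj₁ (proj₂ (Product.isProduct (product A B) f g)))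

  project₂ : ∀ {Z A B} {f : Hom Z A} {g : Hom Z B} → π₂ ∘ ⟨ f , g ⟩ ≡ g
  project₂ {A = A} {B} {f} {g} = proj₂ (proj₁ (proj₂ (Product.isProduct (product A B) f g)))

  ⟨⟩-unique : ∀ {Z A B} {f : Hom Z A} {g : Hom Z B} {h : Hom Z (A ⊗ B)} →
              π₁ ∘ h ≡ f → π₂ ∘ h ≡ g → ⟨ f , g ⟩ ≡ h
  ⟨⟩-unique {A = A} {B} {f} {g} {h} π₁h≡f π₂h≡g =
    proj₂ (proj₂ (Product.isProduct (product A B) f g)) h (π₁h≡f , π₂h≡g)

  ⟨⟩∘ : ∀ {W Z A B} {f : Hom Z A} {g : Hom Z B} {h : Hom W Z} →
        ⟨ f , g ⟩ ∘ h ≡ ⟨ f ∘ h , g ∘ h ⟩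
  ⟨⟩∘ {f = f} {g} {h} = sym (⟨⟩-unique (project-∘ project₁) (project-∘ project₂))
    where
      project-∘ : ∀ {C} {π : Hom _ C} {k : Hom _ C} →
                  π ∘ ⟨ f , g ⟩ ≡ k → π ∘ (⟨ f , g ⟩ ∘ h) ≡ k ∘ h
      project-∘ πfg≡k = trans (sym assoc) (cong (_∘ h) πfg≡k)

  ⟨⟩-injective : ∀ {Z A B} {f f′ : Hom Z A} {g g′ : Hom Z B} →
                 ⟨ f , g ⟩ ≡ ⟨ f′ , g′ ⟩ → f ≡ f′ × g ≡ g′
  ⟨⟩-injective fg≡fg′ =
    trans (sym project₁) (trans (cong (π₁ ∘_) fg≡fg′) project₁) ,
    trans (sym project₂) (trans (cong (π₂ ∘_) fg≡fg′) project₂)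

  δ : ∀ {Y} → Hom Y (Y ⊗ Y)
  δ = ⟨ id , id ⟩

  δ∘ : ∀ {Z Y} {k : Hom Z Y} → δ ∘ k ≡ ⟨ k , k ⟩
  δ∘ = trans ⟨⟩∘ (cong₂ ⟨_,_⟩ identityˡ identityˡ)

  equalizer : ∀ {X Y} (f g : Hom X Y) → Σ Obj λ E → Σ (Hom E X) λ e → IsEqualizer e f g
  equalizer {X} f g = P , p₁ , trans fp₁≡p₂ (sym gp₁≡p₂) , universal
    where
      open Pullback (pullback ⟨ f , g ⟩ δ)
      fp₁≡p₂×gp₁≡p₂ : f ∘ p₁ ≡ p₂ × g ∘ p₁ ≡ p₂
      fp₁≡p₂×gp₁≡p₂ = ⟨⟩-injective (trans (sym ⟨⟩∘) (trans (proj₁ isPullback) δ∘))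
      fp₁≡p₂ : f ∘ p₁ ≡ p₂
      fp₁≡p₂ = proj₁ fp₁≡p₂×gp₁≡p₂
      gp₁≡p₂ : g ∘ p₁ ≡ p₂
      gp₁≡p₂ = proj₂ fp₁≡p₂×gp₁≡p₂
      universal : ∀ {Z} (h : Hom Z X) → f ∘ h ≡ g ∘ h → UniqueEx (λ (u : Hom Z P) → p₁ ∘ u ≡ h)
      universal h fh≡gh =
        let (u , (p₁u≡h , _) , unique) = proj₂ isPullback h (f ∘ h) fgh≡δfh
        in u , p₁u≡h , λ v p₁v≡h → unique v (p₁v≡h , p₂v≡fh v p₁v≡h)
        where
          fgh≡δfh : ⟨ f , g ⟩ ∘ h ≡ δ ∘ (f ∘ h)
          fgh≡δfh = trans ⟨⟩∘ (trans (cong₂ ⟨_,_⟩ refl (sym fh≡gh)) (sym δ∘))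
          p₂v≡fh : ∀ v → p₁ ∘ v ≡ h → p₂ ∘ v ≡ f ∘ h
          p₂v≡fh v p₁v≡h = trans (cong (_∘ v) (sym fp₁≡p₂)) (trans assoc (cong (f ∘_) p₁v≡h))

  Perp⇒epi : ∀ {X′ X Y} {e : Hom X′ X} → Perp M e → (f g : Hom X Y) → f ∘ e ≡ g ∘ e → f ≡ g
  Perp⇒epi {e = e} e⊥M f g fe≡ge =
    let (_ , k , k-equalizes@(fk≡gk , universal)) = equalizer f g
        (_ , ku≡e , _) = universal e fe≡ge
        (s , (_ , ks≡id) , _) =
          e⊥M k (reg⊆M (_ , f , g , k-equalizes)) (trans ku≡e (sym identityˡ))
    in begin
      f             ≡⟨ sym identityʳ ⟩
      f ∘ id        ≡⟨ cong (f ∘_) (sym ks≡id) ⟩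
      f ∘ (k ∘ s)   ≡⟨ sym assoc ⟩
      (f ∘ k) ∘ s   ≡⟨ cong (_∘ s) fk≡gk ⟩
      (g ∘ k) ∘ s   ≡⟨ assoc ⟩
      g ∘ (k ∘ s)   ≡⟨ cong (g ∘_) ks≡id ⟩
      g ∘ id        ≡⟨ identityʳ ⟩
      g             ∎

  M-id : ∀ {Z} → M (id {Z})
  M-id = iso⊆M (id , identityˡ , identityˡ)

  M-cancelʳ : ∀ {X Y Z} {f : Hom X Y} {g : Hom Y Z} → M (g ∘ f) → M f
  M-cancelʳ {f = f} {g} gf∈M =
    let (_ , n , e , n∈M , e⊥M , ne≡f) = factor f
        square : (g ∘ f) ∘ id ≡ (g ∘ n) ∘ e
        square = trans identityʳ (trans (cong (g ∘_) (sym ne≡f)) (sym assoc))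
        (r , (re≡id , _) , _) = e⊥M (g ∘ f) gf∈M square
        er≡id : e ∘ r ≡ id
        er≡id = Perp⇒epi e⊥M (e ∘ r) id
          (trans assoc (trans (cong (e ∘_) re≡id) (trans identityʳ (sym identityˡ))))
    in subst (λ h → M h) ne≡f (M-comp (iso⊆M (r , re≡id , er≡id)) n∈M)

  ⟨⟩-M : ∀ {Z A B} {f : Hom Z A} {g : Hom Z B} → M f → M ⟨ f , g ⟩
  ⟨⟩-M f∈M = M-cancelʳ (subst (λ h → M h) (sym project₁) f∈M)

  ⊤ₛ : ∀ Z → Sub Z
  ⊤ₛ Z = sub Z id M-id

  ≤-trans : ∀ {Y} {S T V : Sub Y} → S ≤ T → T ≤ V → S ≤ V
  ≤-trans (h , Th≡S) (t , Vt≡T) = t ∘ h , trans (sym assoc) (trans (cong (_∘ h) Vt≡T) Th≡S)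

  ≤-isPreorder : ∀ Y → IsPreorder _≡_ (_≤_ {Y})
  ≤-isPreorder Y = record
    { isEquivalence = isEquivalence
    ; reflexive = λ { refl → id , identityʳ }
    ; trans = λ {S} {T} {V} → ≤-trans {S = S} {T} {V}
    }

  ≤-preorder : Obj → Preorder (o ⊔ ℓ ⊔ p) (o ⊔ ℓ ⊔ p) ℓ
  ≤-preorder Y = record { isPreorder = ≤-isPreorder Y }

  module ≤-Reasoning (Y : Obj) = Relation.Binary.Reasoning.Preorder (≤-preorder Y)

  infix 4 _∈_
  record _∈_ {Z Y} (g : Hom Z Y) (S : Sub Y) : Set ℓ where
    constructor _,_
    field
      witness : Hom Z (dom S)
      factors : arr S ∘ witness ≡ g
  open _∈_ public

  arr∈ : ∀ {Y} {S : Sub Y} → arr S ∈ S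
  arr∈ = id , identityʳ

  ∈-∘ : ∀ {Z′ Z Y} {g : Hom Z Y} {S : Sub Y} → g ∈ S → (w : Hom Z′ Z) → g ∘ w ∈ S
  ∈-∘ (h , Sh≡g) w = h ∘ w , trans (sym assoc) (cong (_∘ w) Sh≡g)

  ∈-≤ : ∀ {Z Y} {g : Hom Z Y} {S T : Sub Y} → g ∈ S → S ≤ T → g ∈ T
  ∈-≤ (h , Sh≡g) (t , Tt≡S) = t ∘ h , trans (sym assoc) (trans (cong (_∘ h) Tt≡S) Sh≡g)

  ⟨⟩∈-∘ : ∀ {Z′ Z A B} {f : Hom Z A} {g : Hom Z B} {S : Sub (A ⊗ B)} →
          ⟨ f , g ⟩ ∈ S → (w : Hom Z′ Z) → ⟨ f ∘ w , g ∘ w ⟩ ∈ S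
  ⟨⟩∈-∘ {S = S} fg∈S w = subst (_∈ S) ⟨⟩∘ (∈-∘ fg∈S w)

  ⟨⟩∘-∈ : ∀ {Z′ Z A B} {f : Hom Z A} {g : Hom Z B} {w : Hom Z′ Z} {S : Sub (A ⊗ B)} →
          ⟨ f ∘ w , g ∘ w ⟩ ∈ S → ⟨ f , g ⟩ ∘ w ∈ S
  ⟨⟩∘-∈ {S = S} = subst (_∈ S) (sym ⟨⟩∘)

  arr-⟨⟩∈ : ∀ {A B} {S : Sub (A ⊗ B)} → ⟨ π₁ ∘ arr S , π₂ ∘ arr S ⟩ ∈ S
  arr-⟨⟩∈ {S = S} = subst (_∈ S) (sym (⟨⟩-unique refl refl)) arr∈

  image : ∀ {Z Y} → Hom Z Y → Sub Y
  image g = let (I , n , _ , n∈M , _) = factor g in sub I n n∈M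

  ∈-image : ∀ {Z Y} (g : Hom Z Y) → g ∈ image g
  ∈-image g = let (_ , _ , e , _ , _ , ne≡g) = factor g in e , ne≡g

  image-least : ∀ {Z Y} {g : Hom Z Y} {S : Sub Y} → g ∈ S → image g ≤ S
  image-least {g = g} {S} (h , Sh≡g) =
    let (_ , _ , _ , _ , e⊥M , ne≡g) = factor g
        (d , (_ , Sd≡n) , _) = e⊥M (arr S) (inM S) (trans Sh≡g (sym ne≡g))
    in d , Sd≡n

  ∈⇒≤* : ∀ {X Y} {k : Hom X Y} {S : Sub X} {W : Sub Y} → k ∘ arr S ∈ W → S ≤ (k *) W
  ∈⇒≤* {k = k} {S} {W} (h , Wh≡kS) =
    let (u , (p₁u≡S , _) , _) =
          proj₂ (Pullback.isPullback (pullback k (arr W))) (arr S) h (sym Wh≡kS)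
    in u , p₁u≡S

  ≤*⇒∈ : ∀ {X Y} {k : Hom X Y} {S : Sub X} {W : Sub Y} → S ≤ (k *) W → k ∘ arr S ∈ W
  ≤*⇒∈ {k = k} {S} {W} (h , p₁h≡S) = p₂ ∘ h , (begin
      arr W ∘ (p₂ ∘ h)  ≡⟨ sym assoc ⟩
      (arr W ∘ p₂) ∘ h  ≡⟨ cong (_∘ h) (sym (proj₁ isPullback)) ⟩
      (k ∘ p₁) ∘ h      ≡⟨ assoc ⟩
      k ∘ (p₁ ∘ h)      ≡⟨ cong (k ∘_) p₁h≡S ⟩
      k ∘ arr S         ∎)
    where open Pullback (pullback k (arr W))

  *-∈ : ∀ {X Y} (k : Hom X Y) (W : Sub Y) → k ∘ arr ((k *) W) ∈ W
  *-∈ k W = ≤*⇒∈ {k = k} {(k *) W} {W} (id , identityʳ)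

  ∈⇒⊤≤* : ∀ {X Y} {k : Hom X Y} {W : Sub Y} → k ∈ W → ⊤ₛ X ≤ (k *) W
  ∈⇒⊤≤* {X} {W = W} k∈W = ∈⇒≤* {S = ⊤ₛ X} (subst (_∈ W) (sym identityʳ) k∈W)

  ⊤≤*⇒∈ : ∀ {X Y} {k : Hom X Y} {W : Sub Y} → ⊤ₛ X ≤ (k *) W → k ∈ W
  ⊤≤*⇒∈ {X} {k = k} {W} ⊤≤k*W = subst (_∈ W) identityʳ (≤*⇒∈ {k = k} {⊤ₛ X} {W} ⊤≤k*W)

  IsKernelPair : ∀ {X Y} → Sub (X ⊗ X) → Hom X Y → Set (o ⊔ ℓ)
  IsKernelPair R q = IsPullback q q (π₁ ∘ arr R) (π₂ ∘ arr R)

  kernelPair-∈⇒≡ : ∀ {Z X Y} {R : Sub (X ⊗ X)} {q : Hom X Y} {a b : Hom Z X} →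
                   IsKernelPair R q → ⟨ a , b ⟩ ∈ R → q ∘ a ≡ q ∘ b
  kernelPair-∈⇒≡ {R = R} {q} {a} {b} kp (h , Rh≡ab) = begin
      q ∘ a                    ≡⟨ cong (q ∘_) (component project₁) ⟩
      q ∘ ((π₁ ∘ arr R) ∘ h)   ≡⟨ sym assoc ⟩
      (q ∘ (π₁ ∘ arr R)) ∘ h   ≡⟨ cong (_∘ h) (proj₁ kp) ⟩
      (q ∘ (π₂ ∘ arr R)) ∘ h   ≡⟨ assoc ⟩
      q ∘ ((π₂ ∘ arr R) ∘ h)   ≡⟨ cong (q ∘_) (sym (component project₂)) ⟩
      q ∘ b                    ∎
    where
      component : ∀ {C} {π : Hom _ C} {c : Hom _ C} → π ∘ ⟨ a , b ⟩ ≡ c → c ≡ (π ∘ arr R) ∘ h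
      component πab≡c = trans (sym πab≡c) (trans (cong (_ ∘_) (sym Rh≡ab)) (sym assoc))

  kernelPair-≡⇒∈ : ∀ {Z X Y} {R : Sub (X ⊗ X)} {q : Hom X Y} {a b : Hom Z X} →
                   IsKernelPair R q → q ∘ a ≡ q ∘ b → ⟨ a , b ⟩ ∈ R
  kernelPair-≡⇒∈ {a = a} {b} kp qa≡qb =
    let (u , (r₁u≡a , r₂u≡b) , _) = proj₂ kp a b qa≡qb
    in u , sym (⟨⟩-unique (trans (sym assoc) r₁u≡a) (trans (sym assoc) r₂u≡b))

module CoherentProperties {o ℓ p} {F : FRegularCategory o ℓ p} (bm : IsBooleanModal F) where
  open FRegDefs F
  open FRegularProperties F
  open IsBooleanModal bm using (module BA; *-bot; *-join)

  infixr 6 _∧ₛ_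
  infixr 5 _∨ₛ_

  _∧ₛ_ : ∀ {X} → Sub X → Sub X → Sub X
  _∧ₛ_ {X} = BA._∧_ X

  _∨ₛ_ : ∀ {X} → Sub X → Sub X → Sub X
  _∨ₛ_ {X} = BA._∨_ X

  ⊥ₛ : ∀ X → Sub X
  ⊥ₛ X = BA.bot X

  ∈-∨ˡ : ∀ {Z Y} {g : Hom Z Y} {S T : Sub Y} → g ∈ S → g ∈ S ∨ₛ T
  ∈-∨ˡ {Y = Y} {S = S} {T} g∈S = ∈-≤ g∈S (BA.∨-ub₁ Y S T)

  ∈-∨ʳ : ∀ {Z Y} {g : Hom Z Y} {S T : Sub Y} → g ∈ T → g ∈ S ∨ₛ T
  ∈-∨ʳ {Y = Y} {S = S} {T} g∈T = ∈-≤ g∈T (BA.∨-ub₂ Y S T)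

  ∈-∧ : ∀ {Z Y} {g : Hom Z Y} {S T : Sub Y} → g ∈ S → g ∈ T → g ∈ S ∧ₛ T
  ∈-∧ {Y = Y} {g} {S} {T} g∈S g∈T =
    ∈-≤ (∈-image g) (BA.∧-glb Y {S} {T} {image g} (image-least g∈S) (image-least g∈T))

  ∈-⊥-elim : ∀ {Z Y V} {g : Hom Z Y} {k : Hom Z V} {W : Sub V} → g ∈ ⊥ₛ Y → k ∈ W
  ∈-⊥-elim {Z} {Y} {g = g} {k} {W} g∈⊥ = ⊤≤*⇒∈ (begin
      ⊤ₛ Z            ≲⟨ ∈⇒⊤≤* g∈⊥ ⟩
      (g *) (⊥ₛ Y)    ≲⟨ *-bot g ⟩
      ⊥ₛ Z            ≲⟨ BA.bot-min Z ((k *) W) ⟩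
      (k *) W         ∎)
    where open ≤-Reasoning Z

  ∈-∨-elim : ∀ {Z Y V} {g : Hom Z Y} {S T : Sub Y} {k : Hom Z V} {W : Sub V} → g ∈ S ∨ₛ T →
             (∀ {Z′} (w : Hom Z′ Z) → g ∘ w ∈ S → k ∘ w ∈ W) →
             (∀ {Z′} (w : Hom Z′ Z) → g ∘ w ∈ T → k ∘ w ∈ W) → k ∈ W
  ∈-∨-elim {Z} {g = g} {S} {T} {k} {W} g∈S∨T onS onT = ⊤≤*⇒∈ (begin
      ⊤ₛ Z                  ≲⟨ ∈⇒⊤≤* g∈S∨T ⟩
      (g *) (S ∨ₛ T)        ≲⟨ *-join g S T ⟩
      (g *) S ∨ₛ (g *) T    ≲⟨ BA.∨-lub Z {(g *) S} {(g *) T} {(k *) W} (piece onS) (piece onT) ⟩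
      (k *) W               ∎)
    where
      open ≤-Reasoning Z
      piece : ∀ {S′} → (∀ {Z′} (w : Hom Z′ Z) → g ∘ w ∈ S′ → k ∘ w ∈ W) → (g *) S′ ≤ (k *) W
      piece {S′} on = ∈⇒≤* {k = k} {(g *) S′} {W} (on (arr ((g *) S′)) (*-∈ g S′))

  ∈-∨₃-elim : ∀ {Z Y V} {g : Hom Z Y} {S T T′ : Sub Y} {k : Hom Z V} {W : Sub V} →
              g ∈ (S ∨ₛ T) ∨ₛ T′ →
              (∀ {Z′} (w : Hom Z′ Z) → g ∘ w ∈ S → k ∘ w ∈ W) →
              (∀ {Z′} (w : Hom Z′ Z) → g ∘ w ∈ T → k ∘ w ∈ W) →
              (∀ {Z′} (w : Hom Z′ Z) → g ∘ w ∈ T′ → k ∘ w ∈ W) → k ∈ W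
  ∈-∨₃-elim {Z} {g = g} {k = k} {W} g∈S∨T∨T′ onS onT onT′ =
    ∈-∨-elim g∈S∨T∨T′ (λ w gw∈S∨T → ∈-∨-elim gw∈S∨T (reassoc onS w) (reassoc onT w)) onT′
    where
      reassoc : ∀ {S′} → (∀ {Z′} (w : Hom Z′ Z) → g ∘ w ∈ S′ → k ∘ w ∈ W) →
                ∀ {Z′ Z″} (w : Hom Z′ Z) (w′ : Hom Z″ Z′) → (g ∘ w) ∘ w′ ∈ S′ → (k ∘ w) ∘ w′ ∈ W
      reassoc {S′} on w w′ gww′∈S′ =
        subst (_∈ W) (sym assoc) (on (w ∘ w′) (subst (_∈ S′) assoc gww′∈S′))

module Gluing {o ℓ p} {F : FRegularCategory o ℓ p} (bm : IsBooleanModal F)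
  {A B : FRegDefs.Obj F} (m : FRegDefs.Hom F A B) (m∈M : FRegularCategory.M F m)
  (B+B : DisjointUnion F bm B B) where
  open FRegDefs F
  open FRegularProperties F
  open CoherentProperties bm
  open DisjointUnion B+B
    renaming (ιA to i₁; ιB to i₂; ιA∈M to i₁∈M; ιB∈M to i₂∈M; SA to B₁; SB to B₂)
  open ≡-Reasoning

  disjoint-elim : ∀ {Z V} {a b : Hom Z B} {k : Hom Z V} {W : Sub V} → i₁ ∘ a ≡ i₂ ∘ b → k ∈ W
  disjoint-elim {a = a} {b} i₁a≡i₂b =
    ∈-⊥-elim (∈-≤ (∈-∧ {S = B₁} {B₂} (a , refl) (b , sym i₁a≡i₂b)) meet-bot)

  Δ X₁₂ X₂₁ R : Sub (U ⊗ U)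
  Δ = sub U δ (⟨⟩-M M-id)
  X₁₂ = sub A ⟨ i₁ ∘ m , i₂ ∘ m ⟩ (⟨⟩-M (M-comp m∈M i₁∈M))
  X₂₁ = sub A ⟨ i₂ ∘ m , i₁ ∘ m ⟩ (⟨⟩-M (M-comp m∈M i₂∈M))
  R = (Δ ∨ₛ X₁₂) ∨ₛ X₂₁

  data Glued {Z} (a b : Hom Z U) : Set ℓ where
    same : a ≡ b → Glued a b
    glue₁₂ : (x : Hom Z A) → a ≡ i₁ ∘ m ∘ x → b ≡ i₂ ∘ m ∘ x → Glued a b
    glue₂₁ : (x : Hom Z A) → a ≡ i₂ ∘ m ∘ x → b ≡ i₁ ∘ m ∘ x → Glued a b

  Glued-sym : ∀ {Z} {a b : Hom Z U} → Glued a b → Glued b a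
  Glued-sym (same a≡b) = same (sym a≡b)
  Glued-sym (glue₁₂ x a≡ b≡) = glue₂₁ x b≡ a≡
  Glued-sym (glue₂₁ x a≡ b≡) = glue₁₂ x b≡ a≡

  ∘-through-m : ∀ {Z′ Z} {c : Hom Z U} {i : Hom B U} {x : Hom Z A} (w : Hom Z′ Z) →
                c ≡ i ∘ m ∘ x → c ∘ w ≡ i ∘ m ∘ x ∘ w
  ∘-through-m w c≡ = trans (cong (_∘ w) c≡) (trans assoc (cong (_ ∘_) assoc))

  Glued-∘ : ∀ {Z′ Z} {a b : Hom Z U} → Glued a b → (w : Hom Z′ Z) → Glued (a ∘ w) (b ∘ w)
  Glued-∘ (same a≡b) w = same (cong (_∘ w) a≡b)
  Glued-∘ (glue₁₂ x a≡ b≡) w = glue₁₂ (x ∘ w) (∘-through-m w a≡) (∘-through-m w b≡)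
  Glued-∘ (glue₂₁ x a≡ b≡) w = glue₂₁ (x ∘ w) (∘-through-m w a≡) (∘-through-m w b≡)

  ⟨∘m,∘m⟩∘ : ∀ {Z} {i j : Hom B U} {x : Hom Z A} →
             ⟨ i ∘ m , j ∘ m ⟩ ∘ x ≡ ⟨ i ∘ m ∘ x , j ∘ m ∘ x ⟩
  ⟨∘m,∘m⟩∘ = trans ⟨⟩∘ (cong₂ ⟨_,_⟩ assoc assoc)

  Glued⇒R : ∀ {Z} {a b : Hom Z U} → Glued a b → ⟨ a , b ⟩ ∈ R
  Glued⇒R {a = a} (same refl) = ∈-∨ˡ (∈-∨ˡ (a , δ∘))
  Glued⇒R (glue₁₂ x refl refl) = ∈-∨ˡ (∈-∨ʳ (x , ⟨∘m,∘m⟩∘))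
  Glued⇒R (glue₂₁ x refl refl) = ∈-∨ʳ (x , ⟨∘m,∘m⟩∘)

  Δ⇒Glued : ∀ {Z} {c d : Hom Z U} → ⟨ c , d ⟩ ∈ Δ → Glued c d
  Δ⇒Glued (h , δh≡cd) =
    let (h≡c , h≡d) = ⟨⟩-injective (trans (sym δ∘) δh≡cd) in same (trans (sym h≡c) h≡d)

  X₁₂⇒Glued : ∀ {Z} {c d : Hom Z U} → ⟨ c , d ⟩ ∈ X₁₂ → Glued c d
  X₁₂⇒Glued (x , Xx≡cd) =
    let (c≡ , d≡) = ⟨⟩-injective (trans (sym Xx≡cd) ⟨∘m,∘m⟩∘) in glue₁₂ x c≡ d≡

  X₂₁⇒Glued : ∀ {Z} {c d : Hom Z U} → ⟨ c , d ⟩ ∈ X₂₁ → Glued c d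
  X₂₁⇒Glued (x , Xx≡cd) =
    let (c≡ , d≡) = ⟨⟩-injective (trans (sym Xx≡cd) ⟨∘m,∘m⟩∘) in glue₂₁ x c≡ d≡

  R-elim : ∀ {Z V} {a b : Hom Z U} {k : Hom Z V} {W : Sub V} → ⟨ a , b ⟩ ∈ R →
           (∀ {Z′} (w : Hom Z′ Z) → Glued (a ∘ w) (b ∘ w) → k ∘ w ∈ W) → k ∈ W
  R-elim {Z} {a = a} {b} {k} {W} ab∈R on =
    ∈-∨₃-elim ab∈R (piece Δ⇒Glued) (piece X₁₂⇒Glued) (piece X₂₁⇒Glued)
    where
      piece : ∀ {S} → (∀ {Z′} {c d : Hom Z′ U} → ⟨ c , d ⟩ ∈ S → Glued c d) →
              ∀ {Z′} (w : Hom Z′ Z) → ⟨ a , b ⟩ ∘ w ∈ S → k ∘ w ∈ W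
      piece {S} ⇒Glued w abw∈S = on w (⇒Glued (subst (_∈ S) ⟨⟩∘ abw∈S))

  Glued-trans : ∀ {Z} {a b c : Hom Z U} → Glued a b → Glued b c → ⟨ a , c ⟩ ∈ R
  Glued-trans (same refl) bc = Glued⇒R bc
  Glued-trans ab (same refl) = Glued⇒R ab
  Glued-trans (glue₁₂ _ _ b≡) (glue₁₂ _ b≡′ _) = disjoint-elim (trans (sym b≡′) b≡)
  Glued-trans (glue₁₂ _ a≡ b≡) (glue₂₁ _ b≡′ c≡) =
    Glued⇒R (same (trans a≡ (trans (cong (i₁ ∘_) (M-mono i₂∈M _ _ (trans (sym b≡) b≡′)))
                                   (sym c≡))))
  Glued-trans (glue₂₁ _ a≡ b≡) (glue₁₂ _ b≡′ c≡) =
    Glued⇒R (same (trans a≡ (trans (cong (i₂ ∘_) (M-mono i₁∈M _ _ (trans (sym b≡) b≡′)))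
                                   (sym c≡))))
  Glued-trans (glue₂₁ _ _ b≡) (glue₂₁ _ b≡′ _) = disjoint-elim (trans (sym b≡) b≡′)

  R-sym : ∀ {Z} {a b : Hom Z U} → ⟨ a , b ⟩ ∈ R → ⟨ b , a ⟩ ∈ R
  R-sym ab∈R = R-elim ab∈R (λ w ab → ⟨⟩∘-∈ (Glued⇒R (Glued-sym ab)))

  R-trans : ∀ {Z} {a b c : Hom Z U} → ⟨ a , b ⟩ ∈ R → ⟨ b , c ⟩ ∈ R → ⟨ a , c ⟩ ∈ R
  R-trans ab∈R bc∈R = R-elim ab∈R λ w ab →
    ⟨⟩∘-∈ (R-elim (⟨⟩∈-∘ bc∈R w) λ w′ bc → ⟨⟩∘-∈ (Glued-trans (Glued-∘ ab w′) bc))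

  isEquivalenceRel : IsEquivalenceRel R
  isEquivalenceRel = record
    { reflexive = witness refl∈ , factors refl∈
    ; symmetric = witness sym∈ , factors sym∈
    ; transitive = witness trans∈ , factors trans∈
    }
    where
      open Pullback (pullback (π₂ ∘ arr R) (π₁ ∘ arr R))
      r₁ r₂ : Hom (dom R) U
      r₁ = π₁ ∘ arr R
      r₂ = π₂ ∘ arr R
      refl∈ : ⟨ id , id ⟩ ∈ R
      refl∈ = Glued⇒R (same refl)
      sym∈ : ⟨ r₂ , r₁ ⟩ ∈ R
      sym∈ = R-sym arr-⟨⟩∈
      trans∈ : ⟨ r₁ ∘ p₁ , r₂ ∘ p₂ ⟩ ∈ R
      trans∈ = R-trans (⟨⟩∈-∘ arr-⟨⟩∈ p₁)
                       (subst (λ b → ⟨ b , r₂ ∘ p₂ ⟩ ∈ R) (sym (proj₁ isPullback))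
                              (⟨⟩∈-∘ arr-⟨⟩∈ p₂))

  kernelPair⇒equalizer : ∀ {Y} {q : Hom U Y} → IsKernelPair R q → IsEqualizer m (q ∘ i₁) (q ∘ i₂)
  kernelPair⇒equalizer {q = q} kp = equalizes , universal
    where
      equalizes : (q ∘ i₁) ∘ m ≡ (q ∘ i₂) ∘ m
      equalizes = begin
        (q ∘ i₁) ∘ m   ≡⟨ assoc ⟩
        q ∘ (i₁ ∘ m)   ≡⟨ kernelPair-∈⇒≡ kp (∈-∨ˡ (∈-∨ʳ (arr∈ {S = X₁₂}))) ⟩
        q ∘ (i₂ ∘ m)   ≡⟨ sym assoc ⟩
        (q ∘ i₂) ∘ m   ∎
      universal : ∀ {Z} (h : Hom Z B) → (q ∘ i₁) ∘ h ≡ (q ∘ i₂) ∘ h →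
                  UniqueEx (λ (u : Hom Z A) → m ∘ u ≡ h)
      universal {Z} h qi₁h≡qi₂h =
        witness h∈A , factors h∈A , λ v mv≡h → M-mono m∈M _ _ (trans (factors h∈A) (sym mv≡h))
        where
          local : ∀ {Z′} (w : Hom Z′ Z) → Glued ((i₁ ∘ h) ∘ w) ((i₂ ∘ h) ∘ w) → h ∘ w ∈ sub A m m∈M
          local w (same e) = disjoint-elim (trans (sym assoc) (trans e assoc))
          local w (glue₁₂ x e _) = x , sym (M-mono i₁∈M _ _ (trans (sym assoc) e))
          local w (glue₂₁ x e _) = disjoint-elim (trans (sym assoc) e)
          h∈A : h ∈ sub A m m∈M
          h∈A = R-elim (kernelPair-≡⇒∈ kp (trans (sym assoc) (trans qi₁h≡qi₂h assoc))) local

mainTheorem4 : ∀ {o ℓ p q} (E : BooleanModalQuasiPretopos o ℓ p q) →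
    let open BooleanModalQuasiPretopos E in
    ∀ {A B : FRegDefs.Obj F} (m : FRegDefs.Hom F A B) →
      (FRegularCategory.M F m → FRegDefs.RegularMono F m) ×
      (FRegDefs.RegularMono F m → FRegularCategory.M F m)
mainTheorem4 E {B = B} m = M⇒RegularMono , reg⊆M
  where
    open BooleanModalQuasiPretopos E
    open IsBooleanModalWithQuotients isBMQ using (isBooleanModal)
    open FRegDefs F using (M; RegularMono; reg⊆M; _∘_)
    M⇒RegularMono : M m → RegularMono m
    M⇒RegularMono m∈M =
      let B+B = disjointUnion B B
          open DisjointUnion B+B using (ιA; ιB)
          open Gluing isBooleanModal m m∈M B+B
          (Y , q , _ , R-kernelPair) = effective R isEquivalenceRel
      in Y , q ∘ ιA , q ∘ ιB , kernelPair⇒equalizer R-kernelPair
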